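{- For any small cycle $c=s_{c_{0}} \rightarrow \dots \rightarrow s_{c_{r-1}} \rightarrow s_{c_{0}}$ of $\mathcal{C}(S)$ and any partition of its strings into $r'\le r$ parts as described below, it holds that $\sum_{j=0}^{r'-1}(|\bar{s}_{j}|-2\cdot w(c))\ge o(c)-w(c)$.
   Context: $S$ is a set of finite strings, none a substring of another. For strings $s,t$, $\mathrm{ov}(s,t)$ is the longest suffix of $s$ that is a prefix of $t$ (for $s=t$, the longest proper self-overlap), $\mathrm{pref}(s,t)$ is the string $u$ with $s=u\,\mathrm{ov}(s,t)$, and $\mathrm{dist}(s,t)=|\mathrm{pref}(s,t)|$, so $|s|=\mathrm{dist}(s,t)+|\mathrm{ov}(s,t)|$. $\mathcal{C}(S)$ is the minimum-length cycle cover of the complete directed distance graph on $S$ (edge weights $\mathrm{dist}$), computed by the MGreedy rule (add edges in non-increasing order of overlap length whenever no edge with the same tail or head was already chosen). For a cycle $c$, $w(c)$ is the sum of $\mathrm{dist}$ over its edges and $o(c)$ is the overlap length of its cycle-closing edge (the last edge of $c$ added by MGreedy); every edge of $c$ has overlap length at least $o(c)$. A cycle $c$ is small if $o(c)>2w(c)$. Fix a small cycle $c$ and a partition of its strings into $r'$ parts, each part being a set of strings appearing consecutively along $c$ (i.e., the parts are the directed paths/single nodes remaining after deleting some edges of $c$), numbered in the order they appear on $c$. For part $j$ consisting of strings $t_j^0,\dots,t_j^{\ell_j-1}$ in cycle order, $\bar{s}_j=\mathrm{pref}(t_j^0,t_j^1)\cdots\mathrm{pref}(t_j^{\ell_j-2},t_j^{\ell_j-1})\,t_j^{\ell_j-1}$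 is the string obtained by merging them in that order. -}

module Defs where

open import Data.Bool using (Bool; true; false; if_then_else_; _∨_)
open import Data.Nat using (ℕ; zero; suc; _+_; _∸_; _≤_; _<_; _⊔_; _⊓_)
open import Data.Fin using (Fin; _≟_)
open import Data.List using (List; []; _∷_; _++_; length; take; drop; map; filter; last; cartesianProduct; allFin; concat; foldr)
open import Data.Nat.ListAction using (sum)
open import Data.Bool.ListAction using (any)
open import Data.Integer using (ℤ; 0ℤ) renaming (_+_ to _+ℤ_)
open import Relation.Nullary.Decidable using (T?)
import Data.List.Properties as LP
open import Data.Maybe using (Maybe; just; nothing)
open import Data.Product using (Σ; ∃; ∃₂; _×_; _,_; proj₁; proj₂)
import Data.Product.Properties as PP
open import Relation.Binary.Definitions using (DecidableEquality)
open import Relation.Binary.PropositionalEquality using (_≡_)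
open import Relation.Nullary using (¬_; Dec; yes; no)
open import Relation.Nullary.Decidable using (⌊_⌋)

IsSubstring : {A : Set} → List A → List A → Set
IsSubstring s t = ∃₂ λ u v → t ≡ u ++ s ++ v

sufPre? : {A : Set} → DecidableEquality A → ℕ → List A → List A → Bool
sufPre? eq k s t = ⌊ LP.≡-dec eq (drop (length s ∸ k) s) (take k t) ⌋

searchOv : {A : Set} → DecidableEquality A → ℕ → List A → List A → ℕ
searchOv eq zero    s t = zero
searchOv eq (suc k) s t =
  if sufPre? eq (suc k) s t then suc k else searchOv eq k s t

-- |ov(s,t)|: longest suffix of s that is a prefix of t;
-- for s = t the longest *proper* self-overlap.
ovLen : {A : Set} → DecidableEquality A → List A → List A → ℕ
ovLen eq s t with LP.≡-dec eq s t
... | yes _ = searchOv eq (length s ∸ 1) s t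
... | no  _ = searchOv eq (length s ⊓ length t) s t

dist : {A : Set} → DecidableEquality A → List A → List A → ℕ
dist eq s t = length s ∸ ovLen eq s t

pref : {A : Set} → DecidableEquality A → List A → List A → List A
pref eq s t = take (dist eq s t) s

-- The instance: n strings S : Fin n → List A, edges are pairs (i , j)

Edge : ℕ → Set
Edge n = Fin n × Fin n

edge? : {n : ℕ} → Edge n → Edge n → Bool
edge? (i , j) (k , l) = ⌊ PP.≡-dec _≟_ _≟_ (i , j) (k , l) ⌋

-- all n² edges of the complete directed graph (self-loops included)
allEdges : (n : ℕ) → List (Edge n)
allEdges n = cartesianProduct (allFin n) (allFin n)

conflict : {n : ℕ} → List (Edge n) → Edge n → Bool
conflict chosen (i , j) =
  any (λ e → ⌊ proj₁ e ≟ i ⌋ ∨ ⌊ proj₂ e ≟ j ⌋) chosen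

mgreedyFrom : {n : ℕ} → List (Edge n) → List (Edge n) → List (Edge n)
mgreedyFrom chosen []       = chosen
mgreedyFrom chosen (e ∷ es) =
  if conflict chosen e then mgreedyFrom chosen es
                       else mgreedyFrom (chosen ++ (e ∷ [])) es

mgreedy : {n : ℕ} → List (Edge n) → List (Edge n)
mgreedy = mgreedyFrom []

pathEdges : {n : ℕ} → List (Fin n) → List (Edge n)
pathEdges []           = []
pathEdges (x ∷ [])     = []
pathEdges (x ∷ y ∷ xs) = (x , y) ∷ pathEdges (y ∷ xs)

cycleEdges : {n : ℕ} → List (Fin n) → List (Edge n)
cycleEdges []       = []
cycleEdges (x ∷ xs) with last (x ∷ xs)
... | just y  = pathEdges (x ∷ xs) ++ ((y , x) ∷ [])
... | nothing = pathEdges (x ∷ xs)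

weight : {A : Set} → DecidableEquality A → {n : ℕ} → (Fin n → List A) →
         List (Fin n) → ℕ
weight eq S c = sum (map (λ e → dist eq (S (proj₁ e)) (S (proj₂ e))) (cycleEdges c))

elemEdge : {n : ℕ} → Edge n → List (Edge n) → Bool
elemEdge e es = any (edge? e) es

-- o(c): overlap length of the edge of c added last by MGreedy
-- (the edges of the cover are given in the order they were added)
closingOv : {A : Set} → DecidableEquality A → {n : ℕ} → (Fin n → List A) →
            List (Edge n) → List (Fin n) → ℕ
closingOv eq S cover c with last (filter (λ e → T? (elemEdge e (cycleEdges c))) cover)
... | just (i , j) = ovLen eq (S i) (S j)
... | nothing      = zero

merge : {A : Set} → DecidableEquality A → {n : ℕ} → (Fin n → List A) →
        List (Fin n) → List A
merge eq S []           = []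
merge eq S (x ∷ [])     = S x
merge eq S (x ∷ y ∷ xs) = pref eq (S x) (S y) ++ merge eq S (y ∷ xs)

sumℤ : List ℤ → ℤ
sumℤ = foldr _+ℤ_ 0ℤ

{-# OPTIONS --safe #-}
-- MGreedy adds edges in non-increasing order of overlap and the closing edge of c is
-- added last, so every edge of c has overlap at least o(c).  Merging a part
-- t⁰ … t^{ℓ-1} whose successor on c is t gives
--   |s̄| = dist(t⁰,t¹) + … + dist(t^{ℓ-1},t) + |ov(t^{ℓ-1},t)|,
-- so summing over the r' parts, Σ |s̄_j| ≥ w(c) + r'·o(c).  With o(c) ≥ 2w(c) and r' ≥ 1
-- this is at least r'·2w(c) + o(c) − w(c).
module Submission where

open import Defs
open import Data.Nat using (ℕ; zero; suc; _*_; _<_; _≤_; _+_; z≤n)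
import Data.Nat.Properties as ℕ
open import Algebra.Properties.CommutativeSemigroup ℕ.+-commutativeSemigroup using (interchange)
open import Data.Nat.ListAction using (sum)
open import Data.Nat.ListAction.Properties using (sum-++)
open import Data.Fin using (Fin)
open import Data.Bool using (true; false; T)
open import Data.List using (List; []; _∷_; _++_; length; map; concat; filter; last; head)
import Data.List.Properties as List
open import Data.List.Membership.Propositional using (_∈_)
open import Data.List.Membership.Propositional.Properties using (∈-filter⁺)
open import Data.List.Relation.Unary.Any using (here; there)
import Data.List.Relation.Unary.Any as Any
open import Data.List.Relation.Unary.Any.Properties using (any⁺)
open import Data.List.Relation.Unary.All using (All; []; _∷_)
import Data.List.Relation.Unary.All as All
import Data.List.Relation.Unary.All.Properties as Allₚ
open import Data.List.Relation.Unary.AllPairs using (AllPairs; []; _∷_)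
import Data.List.Relation.Unary.AllPairs.Properties as AllPairs
open import Data.List.Relation.Unary.Linked using (Linked)
open import Data.List.Relation.Unary.Linked.Properties using (Linked⇒AllPairs)
open import Data.List.Relation.Unary.Unique.Propositional using (Unique)
open import Data.List.Relation.Binary.Permutation.Propositional using (_↭_)
open import Data.List.Relation.Binary.Sublist.Propositional using (_⊆_; []; _∷_; _∷ʳ_; ⊆-refl; ⊆-trans; ⊆-reflexive)
open import Data.List.Relation.Binary.Sublist.Propositional.Properties using (All-resp-⊆; ++⁺)
open import Data.Maybe using (just; nothing; fromMaybe)
open import Data.Product using (_,_; proj₁; proj₂)
open import Data.Empty using (⊥-elim)
open import Function using (_$_)
open import Data.Integer using (+_; _-_; _⊖_; _≥_) renaming (_+_ to _+ℤ_; _≤_ to _≤ℤ_)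
import Data.Integer.Properties as ℤ
import Data.Integer.Tactic.RingSolver as ℤ-Solver
import Data.Nat.Tactic.RingSolver as ℕ-Solver
open import Relation.Binary.Definitions using (DecidableEquality; Reflexive; Transitive)
open import Relation.Binary.PropositionalEquality using (_≡_; _≢_; refl; sym; trans; cong; cong₂; subst; subst₂; module ≡-Reasoning)
open import Relation.Nullary using (¬_; yes; no)
open import Relation.Nullary.Decidable using (T?; fromWitness)

AllPairs-resp-⊆ : ∀ {X : Set} {R : X → X → Set} {xs ys : List X} →
                  xs ⊆ ys → AllPairs R ys → AllPairs R xs
AllPairs-resp-⊆ []             rys        = rys
AllPairs-resp-⊆ (_ ∷ʳ xs⊆ys)   (_ ∷ rys)  = AllPairs-resp-⊆ xs⊆ys rys
AllPairs-resp-⊆ (refl ∷ xs⊆ys) (rx ∷ rys) = All-resp-⊆ xs⊆ys rx ∷ AllPairs-resp-⊆ xs⊆ys rys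

last-∈ : ∀ {X : Set} (x : X) xs {y} → last (x ∷ xs) ≡ just y → y ∈ x ∷ xs
last-∈ x []       refl = here refl
last-∈ x (x′ ∷ xs) eq  = there (last-∈ x′ xs eq)

AllPairs-last : ∀ {X : Set} {R : X → X → Set} → Reflexive R →
                ∀ {xs y x} → AllPairs R xs → last xs ≡ just y → x ∈ xs → R x y
AllPairs-last R-refl {x ∷ []}      _          refl (here refl) = R-refl
AllPairs-last R-refl {x ∷ x′ ∷ xs} (rx ∷ _)   eq   (here refl) = All.lookup rx (last-∈ x′ xs eq)
AllPairs-last R-refl {x ∷ x′ ∷ xs} (_ ∷ rxs) eq   (there x∈)  = AllPairs-last R-refl rxs eq x∈

searchOv-≤ : ∀ {A : Set} (eq : DecidableEquality A) k (s t : List A) → searchOv eq k s t ≤ k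
searchOv-≤ eq zero    s t = z≤n
searchOv-≤ eq (suc k) s t with sufPre? eq (suc k) s t
... | true  = ℕ.≤-refl
... | false = ℕ.m≤n⇒m≤1+n (searchOv-≤ eq k s t)

ovLen-≤-length : ∀ {A : Set} (eq : DecidableEquality A) (s t : List A) → ovLen eq s t ≤ length s
ovLen-≤-length eq s t with List.≡-dec eq s t
... | yes _ = ℕ.≤-trans (searchOv-≤ eq _ s t) (ℕ.m∸n≤m (length s) 1)
... | no _  = ℕ.≤-trans (searchOv-≤ eq _ s t) (ℕ.m⊓n≤m (length s) (length t))

length≡dist+ovLen : ∀ {A : Set} (eq : DecidableEquality A) (s t : List A) →
                    length s ≡ dist eq s t + ovLen eq s t
length≡dist+ovLen eq s t = sym (ℕ.m∸n+n≡m (ovLen-≤-length eq s t))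

length-pref : ∀ {A : Set} (eq : DecidableEquality A) (s t : List A) → length (pref eq s t) ≡ dist eq s t
length-pref eq s t =
  trans (List.length-take (dist eq s t) s) (ℕ.m≤n⇒m⊓n≡m (ℕ.m∸n≤m (length s) (ovLen eq s t)))

mgreedyFrom-⊆ : ∀ {n} (chosen es : List (Edge n)) → mgreedyFrom chosen es ⊆ chosen ++ es
mgreedyFrom-⊆ chosen []       = ⊆-reflexive (sym (List.++-identityʳ chosen))
mgreedyFrom-⊆ chosen (e ∷ es) with conflict chosen e
... | true  = ⊆-trans (mgreedyFrom-⊆ chosen es) (++⁺ ⊆-refl (e ∷ʳ ⊆-refl))
... | false = subst (mgreedyFrom (chosen ++ e ∷ []) es ⊆_) (List.++-assoc chosen (e ∷ []) es)
                    (mgreedyFrom-⊆ (chosen ++ e ∷ []) es)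

mgreedy-sorted : ∀ {n} {R : Edge n → Edge n → Set} → Transitive R →
                 ∀ {es} → Linked R es → AllPairs R (mgreedy es)
mgreedy-sorted R-trans {es} sorted =
  AllPairs-resp-⊆ (mgreedyFrom-⊆ [] es) (Linked⇒AllPairs R-trans sorted)

elemEdge-∈ : ∀ {n} {e : Edge n} {es} → e ∈ es → T (elemEdge e es)
elemEdge-∈ {e = e} e∈ = any⁺ (edge? e) (Any.map (λ { refl → fromWitness refl }) e∈)

pathEdgesTo : ∀ {n} → List (Fin n) → Fin n → List (Edge n)
pathEdgesTo []           t = []
pathEdgesTo (x ∷ [])     t = (x , t) ∷ []
pathEdgesTo (x ∷ y ∷ xs) t = (x , y) ∷ pathEdgesTo (y ∷ xs) t

pathEdgesTo-++ : ∀ {n} (xs ys : List (Fin n)) t →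
                 pathEdgesTo (xs ++ ys) t ≡ pathEdgesTo xs (fromMaybe t (head ys)) ++ pathEdgesTo ys t
pathEdgesTo-++ []           ys       t = refl
pathEdgesTo-++ (x ∷ [])     []       t = refl
pathEdgesTo-++ (x ∷ [])     (y ∷ ys) t = refl
pathEdgesTo-++ (x ∷ y ∷ xs) ys       t = cong ((x , y) ∷_) (pathEdgesTo-++ (y ∷ xs) ys t)

pathEdges-∷ʳ : ∀ {n} (xs : List (Fin n)) {y} t → last xs ≡ just y →
               pathEdges xs ++ (y , t) ∷ [] ≡ pathEdgesTo xs t
pathEdges-∷ʳ (x ∷ [])     t refl = refl
pathEdges-∷ʳ (x ∷ y ∷ xs) t eq   = cong ((x , y) ∷_) (pathEdges-∷ʳ (y ∷ xs) t eq)

last-∷≢nothing : ∀ {X : Set} (x : X) xs → last (x ∷ xs) ≢ nothing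
last-∷≢nothing x []        ()
last-∷≢nothing x (x′ ∷ xs) eq = last-∷≢nothing x′ xs eq

cycleEdges≡pathEdgesTo : ∀ {n} (x : Fin n) xs → cycleEdges (x ∷ xs) ≡ pathEdgesTo (x ∷ xs) x
cycleEdges≡pathEdgesTo x xs with last (x ∷ xs) in eq
... | just y  = pathEdges-∷ʳ (x ∷ xs) x eq
... | nothing = ⊥-elim (last-∷≢nothing x xs eq)

module _ {A : Set} (eq : DecidableEquality A) {n : ℕ} (S : Fin n → List A) where

  ovEdge : Edge n → ℕ
  ovEdge (i , j) = ovLen eq (S i) (S j)

  distEdge : Edge n → ℕ
  distEdge (i , j) = dist eq (S i) (S j)

  sumDist : List (Edge n) → ℕ
  sumDist es = sum (map distEdge es)

  sumDist-++ : ∀ es fs → sumDist (es ++ fs) ≡ sumDist es + sumDist fs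
  sumDist-++ es fs = trans (cong sum (List.map-++ distEdge es fs)) (sum-++ (map distEdge es) _)

  closingOv-≤ : ∀ {cover c e} → AllPairs (λ e e′ → ovEdge e′ ≤ ovEdge e) cover →
                e ∈ cover → e ∈ cycleEdges c → closingOv eq S cover c ≤ ovEdge e
  closingOv-≤ {cover} {c} sorted e∈cover e∈c
    with last (filter (λ e → T? (elemEdge e (cycleEdges c))) cover) in eq′
  ... | nothing = z≤n
  ... | just _  = AllPairs-last ℕ.≤-refl (AllPairs.filter⁺ _ sorted) eq′
                    (∈-filter⁺ _ e∈cover (elemEdge-∈ e∈c))

  sumDist+ov≤length-merge : ∀ {o} x xs t → All (λ e → o ≤ ovEdge e) (pathEdgesTo (x ∷ xs) t) →
                            sumDist (pathEdgesTo (x ∷ xs) t) + o ≤ length (merge eq S (x ∷ xs))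
  sumDist+ov≤length-merge {o} x [] t (o≤ov ∷ []) = begin
    distEdge (x , t) + 0 + o        ≡⟨ cong (_+ o) (ℕ.+-identityʳ _) ⟩
    distEdge (x , t) + o            ≤⟨ ℕ.+-monoʳ-≤ _ o≤ov ⟩
    distEdge (x , t) + ovEdge (x , t) ≡⟨ length≡dist+ovLen eq (S x) (S t) ⟨
    length (S x)                    ∎
    where open ℕ.≤-Reasoning
  sumDist+ov≤length-merge {o} x (y ∷ ys) t (_ ∷ o≤ovs) = begin
    distEdge (x , y) + sumDist (pathEdgesTo (y ∷ ys) t) + o   ≡⟨ ℕ.+-assoc (distEdge (x , y)) _ o ⟩
    distEdge (x , y) + (sumDist (pathEdgesTo (y ∷ ys) t) + o) ≤⟨ ℕ.+-monoʳ-≤ _ (sumDist+ov≤length-merge y ys t o≤ovs) ⟩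
    distEdge (x , y) + length (merge eq S (y ∷ ys))           ≡⟨ cong (_+ _) (length-pref eq (S x) (S y)) ⟨
    length (pref eq (S x) (S y)) + length (merge eq S (y ∷ ys)) ≡⟨ List.length-++ (pref eq (S x) (S y)) ⟨
    length (merge eq S (x ∷ y ∷ ys))                          ∎
    where open ℕ.≤-Reasoning

  sumDist+ov≤sum-length-merge : ∀ {o} ps t → All (_≢ []) ps →
    All (λ e → o ≤ ovEdge e) (pathEdgesTo (concat ps) t) →
    sumDist (pathEdgesTo (concat ps) t) + length ps * o ≤ sum (map (λ p → length (merge eq S p)) ps)
  sumDist+ov≤sum-length-merge []              t _             _     = z≤n
  sumDist+ov≤sum-length-merge ([] ∷ ps)       t (p≢[] ∷ _)    _     = ⊥-elim (p≢[] refl)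
  sumDist+ov≤sum-length-merge {o} ((x ∷ xs) ∷ ps) t (_ ∷ ps≢[]) o≤ovs = begin
    sumDist (pathEdgesTo (x ∷ xs ++ concat ps) t) + (o + length ps * o)
      ≡⟨ cong (λ es → sumDist es + _) (pathEdgesTo-++ (x ∷ xs) (concat ps) t) ⟩
    sumDist (head-edges ++ tail-edges) + (o + length ps * o)
      ≡⟨ cong (_+ _) (sumDist-++ head-edges tail-edges) ⟩
    sumDist head-edges + sumDist tail-edges + (o + length ps * o)
      ≡⟨ interchange (sumDist head-edges) _ o _ ⟩
    (sumDist head-edges + o) + (sumDist tail-edges + length ps * o)
      ≤⟨ ℕ.+-mono-≤ (sumDist+ov≤length-merge x xs _ o≤ov-head)
                    (sumDist+ov≤sum-length-merge ps t ps≢[] o≤ov-tail) ⟩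
    sum (map (λ p → length (merge eq S p)) ((x ∷ xs) ∷ ps)) ∎
    where
    open ℕ.≤-Reasoning
    head-edges tail-edges : List (Edge n)
    head-edges = pathEdgesTo (x ∷ xs) (fromMaybe t (head (concat ps)))
    tail-edges = pathEdgesTo (concat ps) t
    o≤ov-head : All (λ e → o ≤ ovEdge e) head-edges
    o≤ov-tail : All (λ e → o ≤ ovEdge e) tail-edges
    o≤ov-head = Allₚ.++⁻ˡ head-edges (subst (All _) (pathEdgesTo-++ (x ∷ xs) (concat ps) t) o≤ovs)
    o≤ov-tail = Allₚ.++⁻ʳ head-edges (subst (All _) (pathEdgesTo-++ (x ∷ xs) (concat ps) t) o≤ovs)

sumℤ-map-sub-const : ∀ {X : Set} (f : X → ℕ) k xs →
                     sumℤ (map (λ x → + f x - + k) xs) ≡ + sum (map f xs) - + (length xs * k)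
sumℤ-map-sub-const f k []       = refl
sumℤ-map-sub-const f k (x ∷ xs) = begin
  (+ f x - + k) +ℤ sumℤ (map (λ x → + f x - + k) xs)
    ≡⟨ cong ((+ f x - + k) +ℤ_) (sumℤ-map-sub-const f k xs) ⟩
  (+ f x - + k) +ℤ (+ sum (map f xs) - + (length xs * k))
    ≡⟨ regroup (+ f x) (+ k) (+ sum (map f xs)) (+ (length xs * k)) ⟩
  (+ f x +ℤ + sum (map f xs)) - (+ k +ℤ + (length xs * k))
    ≡⟨ cong₂ _-_ (ℤ.pos-+ (f x) _) (ℤ.pos-+ k _) ⟨
  + (f x + sum (map f xs)) - + (k + length xs * k) ∎
  where
  open ≡-Reasoning
  regroup : ∀ a b c d → (a - b) +ℤ (c - d) ≡ (a +ℤ c) - (b +ℤ d)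
  regroup = ℤ-Solver.solve-∀

+m-+n≤+o-+p : ∀ {m n o p} → m + p ≤ o + n → + m - + n ≤ℤ + o - + p
+m-+n≤+o-+p {m} {n} {o} {p} m+p≤o+n = begin
  + m - + n         ≡⟨ ℤ.m-n≡m⊖n m n ⟩
  m ⊖ n             ≡⟨ ℤ.+-cancelˡ-⊖ p m n ⟨
  (p + m) ⊖ (p + n) ≤⟨ ℤ.⊖-monoˡ-≤ (p + n) (subst₂ _≤_ (ℕ.+-comm m p) (ℕ.+-comm o n) m+p≤o+n) ⟩
  (n + o) ⊖ (p + n) ≡⟨ cong ((n + o) ⊖_) (ℕ.+-comm p n) ⟩
  (n + o) ⊖ (n + p) ≡⟨ ℤ.+-cancelˡ-⊖ n o p ⟩
  o ⊖ p             ≡⟨ ℤ.m-n≡m⊖n o p ⟨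
  + o - + p         ∎
  where open ℤ.≤-Reasoning

small-cycle-excess : ∀ {w o M} r → 2 * w ≤ o → w + suc r * o ≤ M →
                     + o - + w ≤ℤ + M - + (suc r * (2 * w))
small-cycle-excess {w} {o} {M} r 2w≤o bound = +m-+n≤+o-+p {o} {w} {M} {suc r * (2 * w)} $ begin
  o + (2 * w + r * (2 * w)) ≤⟨ ℕ.+-monoʳ-≤ o (ℕ.+-monoʳ-≤ (2 * w) (ℕ.*-monoʳ-≤ r 2w≤o)) ⟩
  o + (2 * w + r * o)       ≡⟨ regroup w o r ⟩
  (w + suc r * o) + w       ≤⟨ ℕ.+-monoˡ-≤ w bound ⟩
  M + w                     ∎
  where
  open ℕ.≤-Reasoning
  regroup : ∀ w o r → o + (2 * w + r * o) ≡ (w + suc r * o) + w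
  regroup = ℕ-Solver.solve-∀

lemma9 : {A : Set} (eq : DecidableEquality A) (n : ℕ) (S : Fin n → List A) →
    (∀ i j → S i ≡ S j → i ≡ j) →
    (∀ i j → i ≢ j → ¬ IsSubstring (S i) (S j)) →
    (es : List (Edge n)) → es ↭ allEdges n →
    Linked (λ e e′ → ovLen eq (S (proj₁ e′)) (S (proj₂ e′)) ≤ ovLen eq (S (proj₁ e)) (S (proj₂ e))) es →
    (c : List (Fin n)) → c ≢ [] → Unique c →
    All (λ e → e ∈ mgreedy es) (cycleEdges c) →
    2 * weight eq S c < closingOv eq S (mgreedy es) c →
    (parts : List (List (Fin n))) → All (λ p → p ≢ []) parts → concat parts ≡ c →
    sumℤ (map (λ p → + length (merge eq S p) - + (2 * weight eq S c)) parts)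
      ≥ + closingOv eq S (mgreedy es) c - + weight eq S c
lemma9 eq n S _ _ es _ sorted []       c≢[] _ _ _ _ _ _ = ⊥-elim (c≢[] refl)
lemma9 eq n S _ _ es _ sorted (x ∷ xs) _ _ _ _ [] _ ()
lemma9 eq n S _ _ es _ sorted (x ∷ xs) _ _ c⊆cover small parts@(_ ∷ ps) parts≢[] concat≡c = begin
  + o - + w
    ≤⟨ small-cycle-excess {w} {o} (length ps) (ℕ.<⇒≤ small) bound ⟩
  + sum (map mergedLength parts) - + (length parts * (2 * w))
    ≡⟨ sumℤ-map-sub-const mergedLength (2 * w) parts ⟨
  sumℤ (map (λ p → + mergedLength p - + (2 * w)) parts) ∎
  where
  open ℤ.≤-Reasoning
  o w : ℕ
  o = closingOv eq S (mgreedy es) (x ∷ xs)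
  w = weight eq S (x ∷ xs)
  mergedLength : List (Fin n) → ℕ
  mergedLength p = length (merge eq S p)
  edges≡ : cycleEdges (x ∷ xs) ≡ pathEdgesTo (concat parts) x
  edges≡ = trans (cycleEdges≡pathEdgesTo x xs) (cong (λ c → pathEdgesTo c x) (sym concat≡c))
  o≤ov : All (λ e → o ≤ ovEdge eq S e) (cycleEdges (x ∷ xs))
  o≤ov = All.tabulate λ e∈c →
    closingOv-≤ eq S {c = x ∷ xs} (mgreedy-sorted (λ p q → ℕ.≤-trans q p) sorted)
                (All.lookup c⊆cover e∈c) e∈c
  bound : w + length parts * o ≤ sum (map mergedLength parts)
  bound = subst (λ es → sumDist eq S es + length parts * o ≤ sum (map mergedLength parts))
                (sym edges≡)
                (sumDist+ov≤sum-length-merge eq S parts x parts≢[] (subst (All _) edges≡ o≤ov))
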